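{- Let $r,s\ge 1$ be integers. If $H'$ is a subgraph of a finite graph $H$, then $i_{r,s}(H')\le i_{r,s}(H)$.
   Context: Discrete-time immunization model. Fix integers $r,s\ge 1$ and a finite graph $H$. An $(r,s)$-protocol for $H$ is a finite sequence $(A_1,\dots,A_N)$ of subsets of $V(H)$ ($A_t$ is the set of vertices immunized at time-step $t$); its width is $\max_i|A_i|$. At time-step $0$ every vertex is red. For each $t\ge 1$ every vertex lies in exactly one of $G_t^r,\dots,G_t^1$ (green), $Y_t^s,\dots,Y_t^1$ (yellow), $R_t$ (red), determined as follows: if $v\in A_t$ then $v\in G_t^r$. If $v\notin A_t$: if $v$ was red at time $t-1$ or $v\in Y_{t-1}^1$, then $v\in R_t$; if $v\in Y_{t-1}^i$ with $2\le i\le s$, then $v\in Y_t^{i-1}$; if $v\in G_{t-1}^i$ with $2\le i\le r$, then $v\in G_t^{i-1}$; if $v\in G_{t-1}^1$ and $v$ has a neighbor in $R_t$, then $v\in Y_t^s$; otherwise $v\in G_t^1$. The protocol clears $H$ if all vertices are green at time-step $N$. $i_{r,s}(H)$ is the smallest width of an $(r,s)$-protocol that clears $H$. -}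

module Defs where

open import Data.Nat using (ℕ; zero; suc; _⊔_; _≤_)
open import Data.Fin using (Fin)
open import Data.Fin.Subset using (Subset; ∣_∣)
open import Data.Vec using (lookup)
open import Data.Bool using (Bool; true; false; _∧_; not; if_then_else_)
open import Data.List using (List; []; _∷_; foldl; foldr; map; allFin)
open import Data.Bool.ListAction using (any)
open import Data.Product using (Σ; _×_; _,_)
open import Data.Unit using (⊤)
open import Data.Empty using (⊥)
open import Relation.Binary.PropositionalEquality using (_≡_)
open import Function.Definitions using (Injective)

record Graph (n : ℕ) : Set where
  field
    adj   : Fin n → Fin n → Bool
    sym   : ∀ u v → adj u v ≡ adj v u
    irrefl : ∀ v → adj v v ≡ false
open Graph public

-- H' (on Fin m) is a subgraph of H (on Fin n): an injective vertex map
-- under which every edge of H' is an edge of H (i.e. H' is, up to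
-- renaming vertices, a subgraph of H).
Subgraph : ∀ {m n} → Graph m → Graph n → Set
Subgraph {m} {n} H' H =
  Σ (Fin m → Fin n) λ f →
    Injective _≡_ _≡_ f × (∀ u v → adj H' u v ≡ true → adj H (f u) (f v) ≡ true)

-- Vertex states: G i = green G^i (1 ≤ i ≤ r), Y i = yellow Y^i (1 ≤ i ≤ s), R = red.
data State : Set where
  G : ℕ → State
  Y : ℕ → State
  R : State

-- An (r,s)-protocol: the finite sequence (A_1,…,A_N) of immunized sets.
Protocol : ℕ → Set
Protocol n = List (Subset n)

width : ∀ {n} → Protocol n → ℕ
width P = foldr _⊔_ 0 (map ∣_∣ P)

Config : ℕ → Set
Config n = Fin n → State

initial : ∀ {n} → Config n
initial _ = R

redOrY1 : State → Bool
redOrY1 R = true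
redOrY1 (Y 1) = true
redOrY1 _ = false

step : ∀ {n} → ℕ → ℕ → Graph n → Subset n → Config n → Config n
step {n} r s H A c v =
  if lookup A v then G r else next (c v)
  where
  redNow : Fin n → Bool
  redNow u = not (lookup A u) ∧ redOrY1 (c u)
  redNbr : Bool
  redNbr = any (λ u → adj H v u ∧ redNow u) (allFin n)
  next : State → State
  next R = R
  next (Y zero) = R            -- unreachable when s ≥ 1
  next (Y 1) = R
  next (Y (suc (suc i))) = Y (suc i)
  next (G zero) = G zero       -- unreachable when r ≥ 1
  next (G 1) = if redNbr then Y s else G 1
  next (G (suc (suc i))) = G (suc i)

run : ∀ {n} → ℕ → ℕ → Graph n → Protocol n → Config n
run r s H P = foldl (λ c A → step r s H A c) initial P

IsGreen : State → Set
IsGreen (G _) = ⊤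
IsGreen (Y _) = ⊥
IsGreen R = ⊥

Clears : ∀ {n} → ℕ → ℕ → Graph n → Protocol n → Set
Clears r s H P = ∀ v → IsGreen (run r s H P v)

IsImmunizationNumber : ∀ {n} → ℕ → ℕ → Graph n → ℕ → Set
IsImmunizationNumber {n} r s H k =
  Σ (Protocol n) (λ P → Clears r s H P × width P ≡ k)
  × (∀ (P : Protocol n) → Clears r s H P → k ≤ width P)

-- Restrict a protocol that clears H to H' along the embedding f: immunize u
-- exactly when f u is immunized.  Since f is injective this never increases the
-- width.  Order the states by how well protected a vertex is (red worst, Y^i
-- better for larger i, green better than yellow).  By induction on time every
-- vertex u of H' is at least as well protected as f u in H, because a red
-- neighbour of u is mapped to a red neighbour of f u.  So when H is all green,
-- H' is all green as well.
module Submission where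

open import Defs hiding (sym)
open import Data.Nat using (ℕ; zero; suc; _≤_; _<_; z≤n; s≤s)
open import Data.Nat.Properties
  using (≤-refl; ≤-trans; ≤-pred; <-trans; <⇒≤; n<1+n; ⊔-mono-≤; module ≤-Reasoning)
open import Data.Fin using (Fin; zero; suc)
open import Data.Fin.Properties using (suc-injective; 0≢1+n)
open import Data.Fin.Subset using (Subset; ∣_∣; inside; outside)
open import Data.Vec using (_∷_; lookup; tabulate; _[_]≔_)
open import Data.Vec.Properties using (lookup∘tabulate; tabulate-cong; lookup∘update′)
open import Data.Bool using (Bool; true; false; T; _∧_; not; if_then_else_)
open import Data.Bool.Properties using (T-∧; T-≡)
open import Data.Bool.ListAction using (any)
open import Data.List using ([]; _∷_; foldl; map; allFin)
open import Data.List.Membership.Propositional using (lose)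
open import Data.List.Membership.Propositional.Properties using (∈-allFin)
open import Data.List.Relation.Unary.Any using (satisfied)
open import Data.List.Relation.Unary.Any.Properties using (any⁺; any⁻)
open import Data.Product using (_,_)
open import Data.Unit using (tt)
open import Function using (_∘_; Equivalence)
open import Function.Definitions using (Injective)
open import Relation.Binary.PropositionalEquality
  using (_≡_; refl; sym; trans; cong; subst; _≢_)

open Equivalence using (to; from)

pull : ∀ {m n} → (Fin m → Fin n) → Subset n → Subset m
pull f A = tabulate (lookup A ∘ f)

lookup-pull : ∀ {m n} (f : Fin m → Fin n) A v → lookup (pull f A) v ≡ lookup A (f v)
lookup-pull f A = lookup∘tabulate (lookup A ∘ f)

∣p[x]≔outside∣<∣p∣ : ∀ {n} (p : Subset n) x → lookup p x ≡ inside →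
                     ∣ p [ x ]≔ outside ∣ < ∣ p ∣
∣p[x]≔outside∣<∣p∣ (_ ∷ p)       zero    refl = ≤-refl
∣p[x]≔outside∣<∣p∣ (inside ∷ p)  (suc x) e    = s≤s (∣p[x]≔outside∣<∣p∣ p x e)
∣p[x]≔outside∣<∣p∣ (outside ∷ p) (suc x) e    = ∣p[x]≔outside∣<∣p∣ p x e

∣pull∣≤∣p∣ : ∀ {m n} (f : Fin m → Fin n) → Injective _≡_ _≡_ f →
             ∀ A → ∣ pull f A ∣ ≤ ∣ A ∣
∣pull∣≤∣p∣ {zero}  f inj A = z≤n
∣pull∣≤∣p∣ {suc m} f inj A with lookup A (f zero) in e
... | outside = ∣pull∣≤∣p∣ (f ∘ suc) (suc-injective ∘ inj) A
... | inside  = begin-strict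
  ∣ pull (f ∘ suc) A ∣  ≡⟨ cong ∣_∣ (sym (tabulate-cong (λ i →
                              lookup∘update′ (f-suc≢f-zero i) A outside))) ⟩
  ∣ pull (f ∘ suc) A′ ∣ ≤⟨ ∣pull∣≤∣p∣ (f ∘ suc) (suc-injective ∘ inj) A′ ⟩
  ∣ A′ ∣                <⟨ ∣p[x]≔outside∣<∣p∣ A (f zero) e ⟩
  ∣ A ∣                 ∎
  where
  open ≤-Reasoning
  A′ = A [ f zero ]≔ outside
  f-suc≢f-zero : ∀ i → f (suc i) ≢ f zero
  f-suc≢f-zero i = 0≢1+n ∘ sym ∘ inj

width-map-pull : ∀ {m n} (f : Fin m → Fin n) → Injective _≡_ _≡_ f →
                 ∀ (P : Protocol n) → width (map (pull f) P) ≤ width P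
width-map-pull f inj []      = z≤n
width-map-pull f inj (A ∷ P) = ⊔-mono-≤ (∣pull∣≤∣p∣ f inj A) (width-map-pull f inj P)

-- a ≼⟨ s ⟩ b: a vertex in state a is at least as well protected as one in
-- state b.  The bound on yellow indices keeps the order stable under a step,
-- where G¹ can only drop to Yˢ.
data _≼⟨_⟩_ : State → ℕ → State → Set where
  ≼-refl : ∀ {a s} → a ≼⟨ s ⟩ a
  ≼-R    : ∀ {a s} → a ≼⟨ s ⟩ R
  G≼Y    : ∀ {c i s} → i < s → G c ≼⟨ s ⟩ Y (suc i)
  Y≼Y    : ∀ {i j s} → i < s → i ≤ j → Y (suc j) ≼⟨ s ⟩ Y (suc i)

≼-green : ∀ {a b s} → a ≼⟨ s ⟩ b → IsGreen b → IsGreen a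
≼-green ≼-refl g = g

redOrY1-mono : ∀ {a b s} → a ≼⟨ s ⟩ b → T (redOrY1 a) → T (redOrY1 b)
redOrY1-mono ≼-refl                    red = red
redOrY1-mono ≼-R                       _   = tt
redOrY1-mono (Y≼Y {zero}          _ _) _   = tt
redOrY1-mono (Y≼Y {suc i} {suc j} _ _) ()

advance : ℕ → Bool → State → State
advance s redNbr R                 = R
advance s redNbr (Y zero)          = R
advance s redNbr (Y 1)             = R
advance s redNbr (Y (suc (suc i))) = Y (suc i)
advance s redNbr (G zero)          = G zero
advance s redNbr (G 1)             = if redNbr then Y s else G 1
advance s redNbr (G (suc (suc i))) = G (suc i)

advance-mono : ∀ {s a b} → 1 ≤ s → ∀ x y → (T x → T y) → a ≼⟨ s ⟩ b →
               advance s x a ≼⟨ s ⟩ advance s y b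
advance-mono {a = R}               _       _     _     _   ≼-refl = ≼-refl
advance-mono {a = Y zero}          _       _     _     _   ≼-refl = ≼-refl
advance-mono {a = Y 1}             _       _     _     _   ≼-refl = ≼-refl
advance-mono {a = Y (suc (suc i))} _       _     _     _   ≼-refl = ≼-refl
advance-mono {a = G zero}          _       _     _     _   ≼-refl = ≼-refl
advance-mono {a = G (suc (suc c))} _       _     _     _   ≼-refl = ≼-refl
advance-mono {a = G 1}             _       true  true  _   ≼-refl = ≼-refl
advance-mono {a = G 1}             (s≤s _) false true  _   ≼-refl = G≼Y ≤-refl
advance-mono {a = G 1}             _       false false _   ≼-refl = ≼-refl
advance-mono {a = G 1}             _       true  false x⇒y ≼-refl with x⇒y tt
... | ()
advance-mono                       _       _     _     _   ≼-R    = ≼-R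
advance-mono _ _ _ _ (G≼Y {i = zero} _) = ≼-R
advance-mono {a = G zero}          _       _     _ _ (G≼Y {i = suc i} i<s) =
  G≼Y (<-trans (n<1+n i) i<s)
advance-mono {a = G 1}             (s≤s _) true  _ _ (G≼Y {i = suc i} i<s) =
  Y≼Y (<-trans (n<1+n i) i<s) (≤-pred (<⇒≤ i<s))
advance-mono {a = G 1}             _       false _ _ (G≼Y {i = suc i} i<s) =
  G≼Y (<-trans (n<1+n i) i<s)
advance-mono {a = G (suc (suc c))} _       _     _ _ (G≼Y {i = suc i} i<s) =
  G≼Y (<-trans (n<1+n i) i<s)
advance-mono _ _ _ _ (Y≼Y {i = zero} _ _) = ≼-R
advance-mono _ _ _ _ (Y≼Y {i = suc i} {j = suc j} i<s i≤j) =
  Y≼Y (<-trans (n<1+n i) i<s) (≤-pred i≤j)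

hasRedNeighbour : ∀ {n} → Graph n → Subset n → Config n → Fin n → Bool
hasRedNeighbour {n} H A c v =
  any (λ u → adj H v u ∧ (not (lookup A u) ∧ redOrY1 (c u))) (allFin n)

module _ {n} (r s : ℕ) (H : Graph n) (A : Subset n) (c : Config n) (v : Fin n) where

  step-inside : lookup A v ≡ inside → step r s H A c v ≡ G r
  step-inside e rewrite e = refl

  step-outside : lookup A v ≡ outside →
                 step r s H A c v ≡ advance s (hasRedNeighbour H A c v) (c v)
  step-outside e rewrite e with c v
  ... | R               = refl
  ... | Y zero          = refl
  ... | Y 1             = refl
  ... | Y (suc (suc i)) = refl
  ... | G zero          = refl
  ... | G 1             = refl
  ... | G (suc (suc i)) = refl

runFrom : ∀ {n} → ℕ → ℕ → Graph n → Config n → Protocol n → Config n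
runFrom r s H = foldl (λ c A → step r s H A c)

module _ {m n} (r s : ℕ) (H' : Graph m) (H : Graph n) (f : Fin m → Fin n)
         (hom : ∀ u v → adj H' u v ≡ true → adj H (f u) (f v) ≡ true) where

  module _ (A : Subset n) (c' : Config m) (c : Config n)
           (c'≼c : ∀ u → c' u ≼⟨ s ⟩ c (f u)) where

    hasRedNeighbour-mono : ∀ v → T (hasRedNeighbour H' (pull f A) c' v) →
                           T (hasRedNeighbour H A c (f v))
    hasRedNeighbour-mono v red =
      let u , red-u       = satisfied (any⁻ _ (allFin m) red)
          adj-vu , rest   = to T-∧ red-u
          unimm-u , redY1 = to T-∧ rest
          adj-fvfu        = from T-≡ (hom v u (to T-≡ adj-vu))
          unimm-fu        = subst (T ∘ not) (lookup-pull f A u) unimm-u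
      in any⁺ _ (lose (∈-allFin (f u))
           (from T-∧ (adj-fvfu , from T-∧ (unimm-fu , redOrY1-mono (c'≼c u) redY1))))

    step-mono : 1 ≤ s → ∀ v → step r s H' (pull f A) c' v ≼⟨ s ⟩ step r s H A c (f v)
    step-mono 1≤s v = by-side (lookup A (f v)) refl
      where
      by-side : ∀ b → lookup A (f v) ≡ b →
                step r s H' (pull f A) c' v ≼⟨ s ⟩ step r s H A c (f v)
      by-side inside e
        rewrite step-inside r s H' (pull f A) c' v (trans (lookup-pull f A v) e)
              | step-inside r s H A c (f v) e = ≼-refl
      by-side outside e
        rewrite step-outside r s H' (pull f A) c' v (trans (lookup-pull f A v) e)
              | step-outside r s H A c (f v) e =
        advance-mono 1≤s _ _ (hasRedNeighbour-mono v) (c'≼c v)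

  runFrom-mono : 1 ≤ s → ∀ P c' c → (∀ u → c' u ≼⟨ s ⟩ c (f u)) →
                 ∀ u → runFrom r s H' c' (map (pull f) P) u ≼⟨ s ⟩ runFrom r s H c P (f u)
  runFrom-mono 1≤s []      c' c c'≼c = c'≼c
  runFrom-mono 1≤s (A ∷ P) c' c c'≼c =
    runFrom-mono 1≤s P _ _ (step-mono A c' c c'≼c 1≤s)

  map-pull-clears : 1 ≤ s → ∀ P → Clears r s H P → Clears r s H' (map (pull f) P)
  map-pull-clears 1≤s P clears u =
    ≼-green (runFrom-mono 1≤s P initial initial (λ _ → ≼-R) u) (clears (f u))

corollary2p10 : (r s : ℕ) → 1 ≤ r → 1 ≤ s →
    ∀ {m n} (H' : Graph m) (H : Graph n) → Subgraph H' H →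
    ∀ (k' k : ℕ) → IsImmunizationNumber r s H' k' → IsImmunizationNumber r s H k →
    k' ≤ k
corollary2p10 r s _ 1≤s H' H (f , inj , hom) k' k (_ , minimal') ((P , clears , refl) , _) =
  ≤-trans (minimal' (map (pull f) P) (map-pull-clears r s H' H f hom 1≤s P clears))
          (width-map-pull f inj P)
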